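{- For $0\le i\le 2$ and every $k\ge 0$, $(U+I)^2=U^2+I$ maps $F^iG^k$ to $F^i\,T(F^k)$.
   Context: $\mathbb{Z}/2[r]$ is the polynomial ring over the field with two elements; $F=r(r+1)^3$, $G=r^3(r+1)$. $\mathbb{Z}/2[r]$ is a free $\mathbb{Z}/2[G]$-module with basis $1,r,r^2,r^3$. $U:\mathbb{Z}/2[r]\to\mathbb{Z}/2[r]$ is $U\big(\sum_{i=0}^3 g_i(G)r^i\big)=\sum_{i=0}^3 g_i(F)U(r^i)$ with $U(1)=1$, $U(r)=r$, $U(r^2)=r^2$, $U(r^3)=r^3+r^2+r$; $I$ is the identity. $\alpha:\mathbb{Z}/2[F]\to\mathbb{Z}/2[G]$ is the ring isomorphism with $\alpha(F^n)=G^n$, and for $f\in\mathbb{Z}/2[F]$, $T(f)=U(f)+\alpha(f)$. -}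

module Defs where

open import Data.Bool using (Bool; true; false; _xor_; if_then_else_)
open import Data.Nat using (ℕ; zero; suc)
open import Data.List using (List; []; _∷_; take; replicate; _++_; length)
open import Data.List.Relation.Unary.All using (All)
open import Data.Product using (_×_; _,_)
open import Relation.Binary.PropositionalEquality using (_≡_)

-- Polynomials over ℤ/2 (ℤ/2 = Bool with xor as addition, ∧ as multiplication),
-- as little-endian coefficient lists: c₀ ∷ c₁ ∷ … means c₀ + c₁ r + c₂ r² + …
Poly : Set
Poly = List Bool

infixl 6 _⊕_
_⊕_ : Poly → Poly → Poly
[] ⊕ q = q
(a ∷ p) ⊕ [] = a ∷ p
(a ∷ p) ⊕ (b ∷ q) = (a xor b) ∷ (p ⊕ q)

scale : Bool → Poly → Poly
scale true q = q
scale false q = []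

infixl 7 _⊛_
_⊛_ : Poly → Poly → Poly
[] ⊛ q = []
(a ∷ p) ⊛ q = scale a q ⊕ (false ∷ (p ⊛ q))

oneP : Poly
oneP = true ∷ []

rP : Poly
rP = false ∷ true ∷ []

infixr 8 _^P_
_^P_ : Poly → ℕ → Poly
p ^P zero = oneP
p ^P suc n = p ⊛ (p ^P n)

-- equality of polynomials (up to trailing zero coefficients): p + q = 0
infix 4 _≈_
_≈_ : Poly → Poly → Set
p ≈ q = All (_≡ false) (p ⊕ q)

coeff : Poly → ℕ → Bool
coeff [] n = false
coeff (a ∷ p) zero = a
coeff (a ∷ p) (suc n) = coeff p n

F : Poly
F = rP ⊛ ((rP ⊕ oneP) ^P 3)

G : Poly
G = (rP ^P 3) ⊛ (rP ⊕ oneP)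

-- Euclidean division by the monic degree-4 polynomial G:
-- divG p = (q , ρ) with p = q G + ρ and deg ρ < 4.
divG : Poly → Poly × Poly
divG [] = [] , []
divG (c ∷ p) with divG p
... | q , ρ with (c ∷ ρ)
...   | w = if coeff w 4
              then ((true ∷ q) , take 4 (w ⊕ G))
              else ((false ∷ q) , take 4 w)

-- U on the basis elements 1, r, r², r³ of ℤ/2[r] over ℤ/2[G]
Ur³ : Poly
Ur³ = (rP ^P 3) ⊕ (rP ^P 2) ⊕ rP

Ubasis : Poly → Poly
Ubasis ρ = scale (coeff ρ 0) oneP ⊕ scale (coeff ρ 1) rP
         ⊕ scale (coeff ρ 2) (rP ^P 2) ⊕ scale (coeff ρ 3) Ur³

-- U (Σ_n G^n ρ_n) = Σ_n F^n U(ρ_n), via repeated division by G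
-- (fuel: length p levels always suffice, since each division lowers the degree by 4)
Ufuel : ℕ → Poly → Poly
Ufuel zero p = []
Ufuel (suc n) p with divG p
... | q , ρ = Ubasis ρ ⊕ F ⊛ Ufuel n q

U : Poly → Poly
U p = Ufuel (length p) p

evalAt : Poly → Poly → Poly
evalAt [] x = []
evalAt (a ∷ c) x = scale a oneP ⊕ x ⊛ evalAt c x

-- an element f = Σ c_n F^n of ℤ/2[F] is given by its coefficient list c
ZF : Set
ZF = Poly

ιF : ZF → Poly
ιF c = evalAt c F

α : ZF → Poly
α c = evalAt c G

T : ZF → Poly
T c = U (ιF c) ⊕ α c

Fpow : ℕ → ZF
Fpow k = replicate k false ++ (true ∷ [])

UI : Poly → Poly
UI p = U p ⊕ p

-- U is additive and G-semilinear, U(G p) = F U(p), because it agrees with the ℤ/2-linear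
-- map sending rⁿ to Upow n. Semilinearity twice, together with U(Fⁱ) = Gⁱ for i ≤ 2
-- (a finite computation), gives U²(Fⁱ Gᵏ) = U(Fᵏ Gⁱ) = Fⁱ U(Fᵏ).
-- In characteristic 2 an additive U satisfies (U + I)² = U² + I, and
-- U²(Fⁱ Gᵏ) + Fⁱ Gᵏ = Fⁱ (U(Fᵏ) + Gᵏ) = Fⁱ T(Fᵏ).
module Submission where

open import Defs
open import Algebra.Bundles using (AbelianGroup)
open import Data.Bool using (true; false; _xor_; _≟_)
open import Data.Bool.Properties using (xor-comm; xor-assoc; xor-identityʳ; xor-same)
open import Data.List using ([]; _∷_; length; take)
open import Data.List.Relation.Unary.All using (All; []; _∷_; all?)
open import Data.Nat using (ℕ; zero; suc; _+_; _*_; _≤_; s≤s)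
open import Data.Nat.Properties using (≤-trans; m≤m+n; m≤n+m; m≤m*n; +-suc)
open import Data.Product using (_×_; _,_)
open import Function using (id)
open import Relation.Binary.Bundles using (Setoid)
open import Relation.Binary.Structures using (IsEquivalence)
open import Relation.Binary.PropositionalEquality using (_≡_; refl; sym; trans; cong; cong₂)
open import Relation.Nullary.Decidable using (True; toWitness)

infix 4 _≋_
record _≋_ (p q : Poly) : Set where
  constructor coeffwise
  field at : ∀ n → coeff p n ≡ coeff q n
open _≋_

≋-refl : ∀ {p} → p ≋ p
≋-refl .at n = refl

≋-sym : ∀ {p q} → p ≋ q → q ≋ p
≋-sym e .at n = sym (e .at n)

≋-trans : ∀ {p q s} → p ≋ q → q ≋ s → p ≋ s
≋-trans e f .at n = trans (e .at n) (f .at n)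

≋-isEquivalence : IsEquivalence _≋_
≋-isEquivalence = record { refl = ≋-refl ; sym = ≋-sym ; trans = ≋-trans }

≋-setoid : Setoid _ _
≋-setoid = record { isEquivalence = ≋-isEquivalence }

open import Relation.Binary.Reasoning.Setoid ≋-setoid

∷-cong : ∀ a {p q} → p ≋ q → a ∷ p ≋ a ∷ q
∷-cong a e .at zero = refl
∷-cong a e .at (suc n) = e .at n

false∷-≋[] : ∀ {p} → p ≋ [] → false ∷ p ≋ []
false∷-≋[] e .at zero = refl
false∷-≋[] e .at (suc n) = e .at n

xor≡false⇒≡ : ∀ a b → a xor b ≡ false → a ≡ b
xor≡false⇒≡ true true _ = refl
xor≡false⇒≡ false false _ = refl

coeff-⊕ : ∀ p q n → coeff (p ⊕ q) n ≡ coeff p n xor coeff q n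
coeff-⊕ [] q n = refl
coeff-⊕ (a ∷ p) [] zero = sym (xor-identityʳ a)
coeff-⊕ (a ∷ p) [] (suc n) = sym (xor-identityʳ (coeff p n))
coeff-⊕ (a ∷ p) (b ∷ q) zero = refl
coeff-⊕ (a ∷ p) (b ∷ q) (suc n) = coeff-⊕ p q n

⊕-cong : ∀ {p p′ q q′} → p ≋ p′ → q ≋ q′ → p ⊕ q ≋ p′ ⊕ q′
⊕-cong {p} {p′} {q} {q′} e f .at n rewrite coeff-⊕ p q n | coeff-⊕ p′ q′ n =
  cong₂ _xor_ (e .at n) (f .at n)

⊕-comm : ∀ p q → p ⊕ q ≋ q ⊕ p
⊕-comm p q .at n rewrite coeff-⊕ p q n | coeff-⊕ q p n = xor-comm (coeff p n) (coeff q n)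

⊕-assoc : ∀ p q s → (p ⊕ q) ⊕ s ≋ p ⊕ (q ⊕ s)
⊕-assoc p q s .at n
  rewrite coeff-⊕ (p ⊕ q) s n | coeff-⊕ p q n | coeff-⊕ p (q ⊕ s) n | coeff-⊕ q s n =
  xor-assoc (coeff p n) (coeff q n) (coeff s n)

⊕-identityʳ : ∀ p → p ⊕ [] ≋ p
⊕-identityʳ p .at n rewrite coeff-⊕ p [] n = xor-identityʳ (coeff p n)

⊕-congˡ : ∀ {p q q′} → q ≋ q′ → p ⊕ q ≋ p ⊕ q′
⊕-congˡ = ⊕-cong ≋-refl

⊕-congʳ : ∀ {p p′ q} → p ≋ p′ → p ⊕ q ≋ p′ ⊕ q
⊕-congʳ e = ⊕-cong e ≋-refl

⊕-self : ∀ p → p ⊕ p ≋ []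
⊕-self p .at n rewrite coeff-⊕ p p n = xor-same (coeff p n)

⊕-abelianGroup : AbelianGroup _ _
⊕-abelianGroup = record
  { Carrier = Poly
  ; _≈_ = _≋_
  ; _∙_ = _⊕_
  ; ε = []
  ; _⁻¹ = id
  ; isAbelianGroup = record
    { isGroup = record
      { isMonoid = record
        { isSemigroup = record
          { isMagma = record { isEquivalence = ≋-isEquivalence ; ∙-cong = ⊕-cong }
          ; assoc = ⊕-assoc
          }
        ; identity = (λ _ → ≋-refl) , ⊕-identityʳ
        }
      ; inverse = ⊕-self , ⊕-self
      ; ⁻¹-cong = id
      }
    ; comm = ⊕-comm
    }
  }

open AbelianGroup ⊕-abelianGroup using (commutativeSemigroup)
open import Algebra.Properties.CommutativeSemigroup commutativeSemigroup
  using (interchange; x∙yz≈y∙xz)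
open import Algebra.Properties.AbelianGroup ⊕-abelianGroup
  using (x∙y⁻¹≈ε⇒x≈y; x≈y⇒x∙y⁻¹≈ε)

⊕-cancelˡ : ∀ x y → x ⊕ (x ⊕ y) ≋ y
⊕-cancelˡ x y = begin
  x ⊕ (x ⊕ y)  ≈⟨ ⊕-assoc x x y ⟨
  (x ⊕ x) ⊕ y  ≈⟨ ⊕-congʳ (⊕-self x) ⟩
  y            ∎

⊕-cancelʳ : ∀ x y → (x ⊕ y) ⊕ y ≋ x
⊕-cancelʳ x y = begin
  (x ⊕ y) ⊕ y  ≈⟨ ⊕-assoc x y y ⟩
  x ⊕ (y ⊕ y)  ≈⟨ ⊕-congˡ (⊕-self y) ⟩
  x ⊕ []       ≈⟨ ⊕-identityʳ x ⟩
  x            ∎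

⊕-insert : ∀ g x y → x ⊕ y ≋ (g ⊕ x) ⊕ (y ⊕ g)
⊕-insert g x y = begin
  x ⊕ y              ≈⟨ ⊕-congˡ (⊕-cancelˡ g y) ⟨
  x ⊕ (g ⊕ (g ⊕ y))  ≈⟨ ⊕-assoc x g (g ⊕ y) ⟨
  (x ⊕ g) ⊕ (g ⊕ y)  ≈⟨ ⊕-cong (⊕-comm x g) (⊕-comm g y) ⟩
  (g ⊕ x) ⊕ (y ⊕ g)  ∎

⊕-[false] : ∀ p → p ⊕ (false ∷ []) ≋ p
⊕-[false] p = ≋-trans (⊕-congˡ (false∷-≋[] ≋-refl)) (⊕-identityʳ p)

all-false⇒≋[] : ∀ {p} → All (_≡ false) p → p ≋ []
all-false⇒≋[] [] = ≋-refl
all-false⇒≋[] (c≡false ∷ cs) .at zero = c≡false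
all-false⇒≋[] (c≡false ∷ cs) .at (suc n) = all-false⇒≋[] cs .at n

≋[]⇒all-false : ∀ p → p ≋ [] → All (_≡ false) p
≋[]⇒all-false [] e = []
≋[]⇒all-false (c ∷ p) e = e .at zero ∷ ≋[]⇒all-false p (coeffwise λ n → e .at (suc n))

≈⇒≋ : ∀ {x y} → x ≈ y → x ≋ y
≈⇒≋ {x} {y} e = x∙y⁻¹≈ε⇒x≈y x y (all-false⇒≋[] e)

≋⇒≈ : ∀ {x y} → x ≋ y → x ≈ y
≋⇒≈ {x} {y} e = ≋[]⇒all-false (x ⊕ y) (x≈y⇒x∙y⁻¹≈ε e)

≋-byComputation : ∀ p q → {True (all? (_≟ false) (p ⊕ q))} → p ≋ q
≋-byComputation p q {w} = ≈⇒≋ (toWitness w)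

scale-cong : ∀ a {p q} → p ≋ q → scale a p ≋ scale a q
scale-cong true e = e
scale-cong false e = ≋-refl

scale-⊕ : ∀ a x y → scale a (x ⊕ y) ≋ scale a x ⊕ scale a y
scale-⊕ true x y = ≋-refl
scale-⊕ false x y = ≋-refl

scale-⊛ : ∀ a q s → scale a q ⊛ s ≋ scale a (q ⊛ s)
scale-⊛ true q s = ≋-refl
scale-⊛ false q s = ≋-refl

⊛-zeroʳ : ∀ p → p ⊛ [] ≋ []
⊛-zeroʳ [] = ≋-refl
⊛-zeroʳ (true ∷ p) = false∷-≋[] (⊛-zeroʳ p)
⊛-zeroʳ (false ∷ p) = false∷-≋[] (⊛-zeroʳ p)

⊛-scale : ∀ p a x → p ⊛ scale a x ≋ scale a (p ⊛ x)
⊛-scale p true x = ≋-refl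
⊛-scale p false x = ⊛-zeroʳ p

⊛-congˡ : ∀ p {q q′} → q ≋ q′ → p ⊛ q ≋ p ⊛ q′
⊛-congˡ [] e = ≋-refl
⊛-congˡ (a ∷ p) e = ⊕-cong (scale-cong a e) (∷-cong false (⊛-congˡ p e))

⊛-distribˡ-⊕ : ∀ p q q′ → p ⊛ (q ⊕ q′) ≋ p ⊛ q ⊕ p ⊛ q′
⊛-distribˡ-⊕ [] q q′ = ≋-refl
⊛-distribˡ-⊕ (a ∷ p) q q′ = begin
  scale a (q ⊕ q′) ⊕ (false ∷ p ⊛ (q ⊕ q′))
    ≈⟨ ⊕-cong (scale-⊕ a q q′) (∷-cong false (⊛-distribˡ-⊕ p q q′)) ⟩
  (scale a q ⊕ scale a q′) ⊕ ((false ∷ p ⊛ q) ⊕ (false ∷ p ⊛ q′))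
    ≈⟨ interchange (scale a q) (scale a q′) (false ∷ p ⊛ q) (false ∷ p ⊛ q′) ⟩
  (scale a q ⊕ (false ∷ p ⊛ q)) ⊕ (scale a q′ ⊕ (false ∷ p ⊛ q′))
    ∎

⊛-∷ʳ : ∀ p b q → p ⊛ (b ∷ q) ≋ scale b p ⊕ (false ∷ p ⊛ q)
⊛-∷ʳ [] true q = ≋-sym (false∷-≋[] ≋-refl)
⊛-∷ʳ [] false q = ≋-sym (false∷-≋[] ≋-refl)
⊛-∷ʳ (a ∷ p) b q =
  ≋-trans (⊕-congˡ (∷-cong false (⊛-∷ʳ p b q))) (exchange a b)
  where
  R = false ∷ p ⊛ q
  exchange : ∀ a b → scale a (b ∷ q) ⊕ (false ∷ (scale b p ⊕ R))
                   ≋ scale b (a ∷ p) ⊕ (false ∷ (scale a q ⊕ R))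
  exchange true true = ∷-cong true (x∙yz≈y∙xz q p R)
  exchange true false = ≋-refl
  exchange false true = ≋-refl
  exchange false false = ≋-refl

⊛-comm : ∀ p q → p ⊛ q ≋ q ⊛ p
⊛-comm [] q = ≋-sym (⊛-zeroʳ q)
⊛-comm (a ∷ p) q =
  ≋-trans (⊕-congˡ (∷-cong false (⊛-comm p q))) (≋-sym (⊛-∷ʳ q a p))

⊛-distribʳ-⊕ : ∀ q p p′ → (p ⊕ p′) ⊛ q ≋ p ⊛ q ⊕ p′ ⊛ q
⊛-distribʳ-⊕ q p p′ = begin
  (p ⊕ p′) ⊛ q       ≈⟨ ⊛-comm (p ⊕ p′) q ⟩
  q ⊛ (p ⊕ p′)       ≈⟨ ⊛-distribˡ-⊕ q p p′ ⟩
  q ⊛ p ⊕ q ⊛ p′     ≈⟨ ⊕-cong (⊛-comm q p) (⊛-comm q p′) ⟩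
  p ⊛ q ⊕ p′ ⊛ q     ∎

⊛-assoc : ∀ p q s → (p ⊛ q) ⊛ s ≋ p ⊛ (q ⊛ s)
⊛-assoc [] q s = ≋-refl
⊛-assoc (a ∷ p) q s =
  ≋-trans (⊛-distribʳ-⊕ s (scale a q) (false ∷ p ⊛ q))
          (⊕-cong (scale-⊛ a q s) (∷-cong false (⊛-assoc p q s)))

⊛-identityˡ : ∀ p → oneP ⊛ p ≋ p
⊛-identityˡ = ⊕-[false]

evalAt-Fpow : ∀ k x → evalAt (Fpow k) x ≋ x ^P k
evalAt-Fpow zero x = ≋-trans (⊕-congˡ (⊛-zeroʳ x)) (⊕-identityʳ oneP)
evalAt-Fpow (suc k) x = ⊛-congˡ x (evalAt-Fpow k x)

-- r⁴ = G + r³, so semilinearity forces U(rⁿ⁺⁴) = F U(rⁿ) + U(rⁿ⁺³).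
Upow : ℕ → Poly
Upow zero = oneP
Upow (suc zero) = rP
Upow (suc (suc zero)) = rP ^P 2
Upow (suc (suc (suc zero))) = Ur³
Upow (suc (suc (suc (suc n)))) = F ⊛ Upow n ⊕ Upow (suc (suc (suc n)))

-- Ulin m p is the image of rᵐ p under the linear map rⁿ ↦ Upow n.
Ulin : ℕ → Poly → Poly
Ulin m [] = []
Ulin m (a ∷ p) = scale a (Upow m) ⊕ Ulin (suc m) p

Ulin-zero : ∀ m {p} → p ≋ [] → Ulin m p ≋ []
Ulin-zero m {[]} e = ≋-refl
Ulin-zero m {true ∷ p} e with e .at zero
... | ()
Ulin-zero m {false ∷ p} e = Ulin-zero (suc m) {p} (coeffwise λ n → e .at (suc n))

Ulin-⊕ : ∀ m p q → Ulin m (p ⊕ q) ≋ Ulin m p ⊕ Ulin m q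
Ulin-⊕ m [] q = ≋-refl
Ulin-⊕ m (a ∷ p) [] = ≋-sym (⊕-identityʳ _)
Ulin-⊕ m (a ∷ p) (b ∷ q) = begin
  scale (a xor b) (Upow m) ⊕ Ulin (suc m) (p ⊕ q)
    ≈⟨ ⊕-cong (scale-xor a b) (Ulin-⊕ (suc m) p q) ⟩
  (scale a (Upow m) ⊕ scale b (Upow m)) ⊕ (Ulin (suc m) p ⊕ Ulin (suc m) q)
    ≈⟨ interchange (scale a (Upow m)) (scale b (Upow m)) (Ulin (suc m) p) (Ulin (suc m) q) ⟩
  (scale a (Upow m) ⊕ Ulin (suc m) p) ⊕ (scale b (Upow m) ⊕ Ulin (suc m) q)
    ∎
  where
  scale-xor : ∀ a b → scale (a xor b) (Upow m) ≋ scale a (Upow m) ⊕ scale b (Upow m)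
  scale-xor true true = ≋-sym (⊕-self (Upow m))
  scale-xor true false = ≋-sym (⊕-identityʳ (Upow m))
  scale-xor false b = ≋-refl

Ulin-cong : ∀ m {p q} → p ≋ q → Ulin m p ≋ Ulin m q
Ulin-cong m {p} {q} e = x∙y⁻¹≈ε⇒x≈y (Ulin m p) (Ulin m q) (begin
  Ulin m p ⊕ Ulin m q  ≈⟨ Ulin-⊕ m p q ⟨
  Ulin m (p ⊕ q)       ≈⟨ Ulin-zero m (x≈y⇒x∙y⁻¹≈ε e) ⟩
  []                   ∎)

Ulin-shift : ∀ m p → Ulin (4 + m) p ≋ F ⊛ Ulin m p ⊕ Ulin (3 + m) p
Ulin-shift m [] = ≋-sym (≋-trans (⊕-identityʳ (F ⊛ [])) (⊛-zeroʳ F))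
Ulin-shift m (a ∷ p) = begin
  scale a (F ⊛ Upow m ⊕ Upow (3 + m)) ⊕ Ulin (5 + m) p
    ≈⟨ ⊕-cong (scale-⊕ a (F ⊛ Upow m) (Upow (3 + m))) (Ulin-shift (suc m) p) ⟩
  (scale a (F ⊛ Upow m) ⊕ scale a (Upow (3 + m))) ⊕ (F ⊛ Ulin (suc m) p ⊕ Ulin (4 + m) p)
    ≈⟨ interchange (scale a (F ⊛ Upow m)) _ (F ⊛ Ulin (suc m) p) _ ⟩
  (scale a (F ⊛ Upow m) ⊕ F ⊛ Ulin (suc m) p) ⊕ Ulin (3 + m) (a ∷ p)
    ≈⟨ ⊕-congʳ (⊕-congʳ (⊛-scale F a (Upow m))) ⟨
  (F ⊛ scale a (Upow m) ⊕ F ⊛ Ulin (suc m) p) ⊕ Ulin (3 + m) (a ∷ p)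
    ≈⟨ ⊕-congʳ {q = Ulin (3 + m) (a ∷ p)}
               (⊛-distribˡ-⊕ F (scale a (Upow m)) (Ulin (suc m) p)) ⟨
  F ⊛ Ulin m (a ∷ p) ⊕ Ulin (3 + m) (a ∷ p)
    ∎

-- G computes to the coefficient list of r³ + r⁴.
Ulin-G : ∀ p → Ulin 0 (G ⊛ p) ≋ F ⊛ Ulin 0 p
Ulin-G p = begin
  Ulin 0 (G ⊛ p)
    ≡⟨⟩
  Ulin 3 (p ⊕ (false ∷ p ⊕ (false ∷ [])))
    ≈⟨ Ulin-⊕ 3 p (false ∷ p ⊕ (false ∷ [])) ⟩
  Ulin 3 p ⊕ Ulin 4 (p ⊕ (false ∷ []))
    ≈⟨ ⊕-congˡ (Ulin-cong 4 (⊕-[false] p)) ⟩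
  Ulin 3 p ⊕ Ulin 4 p
    ≈⟨ ⊕-congˡ (Ulin-shift 0 p) ⟩
  Ulin 3 p ⊕ (F ⊛ Ulin 0 p ⊕ Ulin 3 p)
    ≈⟨ ⊕-congˡ {Ulin 3 p} (⊕-comm (F ⊛ Ulin 0 p) (Ulin 3 p)) ⟩
  Ulin 3 p ⊕ (Ulin 3 p ⊕ F ⊛ Ulin 0 p)
    ≈⟨ ⊕-cancelˡ (Ulin 3 p) (F ⊛ Ulin 0 p) ⟩
  F ⊛ Ulin 0 p
    ∎

Ulin-basis : ∀ a b c d → Ulin 0 (a ∷ b ∷ c ∷ d ∷ []) ≋ Ubasis (a ∷ b ∷ c ∷ d ∷ [])
Ulin-basis a b c d = begin
  A ⊕ (B ⊕ (C ⊕ (D ⊕ [])))  ≈⟨ ⊕-congˡ {A} (⊕-congˡ {B} (⊕-congˡ {C} (⊕-identityʳ D))) ⟩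
  A ⊕ (B ⊕ (C ⊕ D))         ≈⟨ ⊕-assoc A B (C ⊕ D) ⟨
  (A ⊕ B) ⊕ (C ⊕ D)         ≈⟨ ⊕-assoc (A ⊕ B) C D ⟨
  ((A ⊕ B) ⊕ C) ⊕ D         ∎
  where
  A = scale a oneP
  B = scale b rP
  C = scale c (rP ^P 2)
  D = scale d Ur³

VanishesFrom : ℕ → Poly → Set
VanishesFrom m p = ∀ j → coeff p (m + j) ≡ false

vanishes-resp-≋ : ∀ {m p q} → p ≋ q → VanishesFrom m p → VanishesFrom m q
vanishes-resp-≋ {m} e h j = trans (sym (e .at (m + j))) (h j)

vanishes-⊕ : ∀ {m} p q → VanishesFrom m p → VanishesFrom m q → VanishesFrom m (p ⊕ q)
vanishes-⊕ {m} p q hp hq j rewrite coeff-⊕ p q (m + j) | hp j | hq j = refl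

coeff-beyond-length : ∀ p {n} → length p ≤ n → coeff p n ≡ false
coeff-beyond-length [] _ = refl
coeff-beyond-length (a ∷ p) (s≤s h) = coeff-beyond-length p h

constant-from⇒vanishes : ∀ N q → (∀ j → coeff q (N + j) ≡ coeff q (suc (N + j))) →
                         VanishesFrom N q
constant-from⇒vanishes N q step j =
  trans (constant (length q))
        (coeff-beyond-length q (≤-trans (m≤m+n (length q) j) (m≤n+m (length q + j) N)))
  where
  constant : ∀ m → coeff q (N + j) ≡ coeff q (N + (m + j))
  constant zero = refl
  constant (suc m) = trans (constant m) (trans (step (m + j)) (cong (coeff q) (sym (+-suc N (m + j)))))

coeff-⊛G : ∀ q m → coeff (q ⊛ G) (4 + m) ≡ coeff q m xor coeff q (suc m)
coeff-⊛G q m =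
  trans (⊛-comm q G .at (4 + m))
  (trans (coeff-⊕ q (false ∷ q ⊕ (false ∷ [])) (suc m))
  (trans (cong (coeff q (suc m) xor_) (⊕-[false] q .at m))
         (xor-comm (coeff q (suc m)) (coeff q m))))

quotient-vanishes : ∀ N q → VanishesFrom (4 + N) (q ⊛ G) → VanishesFrom N q
quotient-vanishes N q h = constant-from⇒vanishes N q λ j →
  xor≡false⇒≡ _ _ (trans (sym (coeff-⊛G q (N + j))) (h j))

take4-vanishes : ∀ x → VanishesFrom 4 (take 4 x)
take4-vanishes [] j = refl
take4-vanishes (a ∷ []) j = refl
take4-vanishes (a ∷ b ∷ []) j = refl
take4-vanishes (a ∷ b ∷ c ∷ []) j = refl
take4-vanishes (a ∷ b ∷ c ∷ d ∷ x) j = refl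

take4-≋ : ∀ x → VanishesFrom 4 x → take 4 x ≋ x
take4-≋ [] h = ≋-refl
take4-≋ (a ∷ []) h = ≋-refl
take4-≋ (a ∷ b ∷ []) h = ≋-refl
take4-≋ (a ∷ b ∷ c ∷ []) h = ≋-refl
take4-≋ (a ∷ b ∷ c ∷ d ∷ x) h = ∷-cong a (∷-cong b (∷-cong c (∷-cong d
  (≋-sym (coeffwise h)))))

IsDivisionByG : Poly → Poly × Poly → Set
IsDivisionByG p (q , ρ) = (p ≋ q ⊛ G ⊕ ρ) × VanishesFrom 4 ρ

divG-correct : ∀ p → IsDivisionByG p (divG p)
divG-correct [] = ≋-refl , λ _ → refl
divG-correct (c ∷ p) with divG p | divG-correct p
... | q , ρ | p≋ , ρ-vanishes with coeff ρ 3 in ρ₃≡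
... | true = c∷p≋ , take4-vanishes X
  where
  X = (c ∷ ρ) ⊕ G
  X-vanishes : VanishesFrom 4 X
  X-vanishes zero rewrite coeff-⊕ (c ∷ ρ) G 4 | ρ₃≡ = refl
  X-vanishes (suc j) rewrite coeff-⊕ (c ∷ ρ) G (5 + j) | ρ-vanishes j = refl
  c∷p≋ : c ∷ p ≋ (true ∷ q) ⊛ G ⊕ take 4 X
  c∷p≋ = begin
    c ∷ p                      ≈⟨ ∷-cong c p≋ ⟩
    (false ∷ q ⊛ G) ⊕ (c ∷ ρ)  ≈⟨ ⊕-insert G (false ∷ q ⊛ G) (c ∷ ρ) ⟩
    (G ⊕ (false ∷ q ⊛ G)) ⊕ X  ≈⟨ ⊕-congˡ {G ⊕ (false ∷ q ⊛ G)} (take4-≋ X X-vanishes) ⟨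
    (true ∷ q) ⊛ G ⊕ take 4 X  ∎
... | false = c∷p≋ , take4-vanishes (c ∷ ρ)
  where
  cρ-vanishes : VanishesFrom 4 (c ∷ ρ)
  cρ-vanishes zero = ρ₃≡
  cρ-vanishes (suc j) = ρ-vanishes j
  c∷p≋ : c ∷ p ≋ (false ∷ q ⊛ G) ⊕ take 4 (c ∷ ρ)
  c∷p≋ = ≋-trans (∷-cong c p≋)
                 (⊕-congˡ {false ∷ q ⊛ G} (≋-sym (take4-≋ (c ∷ ρ) cρ-vanishes)))

Ulin-remainder : ∀ ρ → VanishesFrom 4 ρ → Ulin 0 ρ ≋ Ubasis ρ
Ulin-remainder ρ h =
  ≋-trans (Ulin-cong 0 ρ≋) (Ulin-basis (coeff ρ 0) (coeff ρ 1) (coeff ρ 2) (coeff ρ 3))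
  where
  ρ≋ : ρ ≋ coeff ρ 0 ∷ coeff ρ 1 ∷ coeff ρ 2 ∷ coeff ρ 3 ∷ []
  ρ≋ .at zero = refl
  ρ≋ .at (suc zero) = refl
  ρ≋ .at (suc (suc zero)) = refl
  ρ≋ .at (suc (suc (suc zero))) = refl
  ρ≋ .at (suc (suc (suc (suc j)))) = h j

Ufuel≋Ulin : ∀ n p → VanishesFrom (n * 4) p → Ufuel n p ≋ Ulin 0 p
Ufuel≋Ulin zero p h = ≋-sym (Ulin-zero 0 {p} (coeffwise h))
Ufuel≋Ulin (suc n) p h with divG p | divG-correct p
... | q , ρ | p≋ , ρ-vanishes = begin
  Ubasis ρ ⊕ F ⊛ Ufuel n q
    ≈⟨ ⊕-cong (≋-sym (Ulin-remainder ρ ρ-vanishes)) (⊛-congˡ F (Ufuel≋Ulin n q q-vanishes)) ⟩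
  Ulin 0 ρ ⊕ F ⊛ Ulin 0 q        ≈⟨ ⊕-comm (Ulin 0 ρ) (F ⊛ Ulin 0 q) ⟩
  F ⊛ Ulin 0 q ⊕ Ulin 0 ρ        ≈⟨ ⊕-congʳ (Ulin-G q) ⟨
  Ulin 0 (G ⊛ q) ⊕ Ulin 0 ρ      ≈⟨ ⊕-congʳ (Ulin-cong 0 (⊛-comm G q)) ⟩
  Ulin 0 (q ⊛ G) ⊕ Ulin 0 ρ      ≈⟨ Ulin-⊕ 0 (q ⊛ G) ρ ⟨
  Ulin 0 (q ⊛ G ⊕ ρ)             ≈⟨ Ulin-cong 0 p≋ ⟨
  Ulin 0 p                       ∎
  where
  q-vanishes : VanishesFrom (n * 4) q
  q-vanishes = quotient-vanishes (n * 4) q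
    (vanishes-resp-≋ (≋-trans (⊕-congʳ p≋) (⊕-cancelʳ (q ⊛ G) ρ))
                     (vanishes-⊕ p ρ h (λ j → ρ-vanishes (n * 4 + j))))

U≋Ulin : ∀ p → U p ≋ Ulin 0 p
U≋Ulin p = Ufuel≋Ulin (length p) p λ j →
  coeff-beyond-length p (≤-trans (m≤m*n (length p) 4) (m≤m+n _ j))

U-cong : ∀ {p q} → p ≋ q → U p ≋ U q
U-cong {p} {q} e = ≋-trans (U≋Ulin p) (≋-trans (Ulin-cong 0 e) (≋-sym (U≋Ulin q)))

U-⊕ : ∀ p q → U (p ⊕ q) ≋ U p ⊕ U q
U-⊕ p q = ≋-trans (U≋Ulin (p ⊕ q))
  (≋-trans (Ulin-⊕ 0 p q) (⊕-cong (≋-sym (U≋Ulin p)) (≋-sym (U≋Ulin q))))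

U-G⊛ : ∀ p → U (G ⊛ p) ≋ F ⊛ U p
U-G⊛ p = ≋-trans (U≋Ulin (G ⊛ p)) (≋-trans (Ulin-G p) (⊛-congˡ F (≋-sym (U≋Ulin p))))

U-Gpow⊛ : ∀ k p → U (G ^P k ⊛ p) ≋ F ^P k ⊛ U p
U-Gpow⊛ zero p = ≋-trans (U-cong (⊛-identityˡ p)) (≋-sym (⊛-identityˡ (U p)))
U-Gpow⊛ (suc k) p = begin
  U ((G ⊛ G ^P k) ⊛ p)   ≈⟨ U-cong (⊛-assoc G (G ^P k) p) ⟩
  U (G ⊛ (G ^P k ⊛ p))   ≈⟨ U-G⊛ (G ^P k ⊛ p) ⟩
  F ⊛ U (G ^P k ⊛ p)     ≈⟨ ⊛-congˡ F (U-Gpow⊛ k p) ⟩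
  F ⊛ (F ^P k ⊛ U p)     ≈⟨ ⊛-assoc F (F ^P k) (U p) ⟨
  (F ⊛ F ^P k) ⊛ U p     ∎

U-Fpow : ∀ i → i ≤ 2 → U (F ^P i) ≋ G ^P i
U-Fpow 0 _ = ≋-byComputation (U (F ^P 0)) (G ^P 0)
U-Fpow 1 _ = ≋-byComputation (U (F ^P 1)) (G ^P 1)
U-Fpow 2 _ = ≋-byComputation (U (F ^P 2)) (G ^P 2)
U-Fpow (suc (suc (suc i))) (s≤s (s≤s ()))

UI-square : ∀ p → UI (UI p) ≋ U (U p) ⊕ p
UI-square p = begin
  U (U p ⊕ p) ⊕ (U p ⊕ p)          ≈⟨ ⊕-congʳ (U-⊕ (U p) p) ⟩
  (U (U p) ⊕ U p) ⊕ (U p ⊕ p)      ≈⟨ ⊕-assoc (U (U p)) (U p) (U p ⊕ p) ⟩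
  U (U p) ⊕ (U p ⊕ (U p ⊕ p))      ≈⟨ ⊕-congˡ (⊕-cancelˡ (U p) p) ⟩
  U (U p) ⊕ p                      ∎

T-Fpow : ∀ k → T (Fpow k) ≋ U (F ^P k) ⊕ G ^P k
T-Fpow k = ⊕-cong (U-cong (evalAt-Fpow k F)) (evalAt-Fpow k G)

U²-Fpow⊛Gpow : ∀ i → i ≤ 2 → ∀ k → U (U (F ^P i ⊛ G ^P k)) ≋ F ^P i ⊛ U (F ^P k)
U²-Fpow⊛Gpow i i≤2 k = begin
  U (U (F ^P i ⊛ G ^P k))    ≈⟨ U-cong (U-cong (⊛-comm (F ^P i) (G ^P k))) ⟩
  U (U (G ^P k ⊛ F ^P i))    ≈⟨ U-cong (U-Gpow⊛ k (F ^P i)) ⟩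
  U (F ^P k ⊛ U (F ^P i))    ≈⟨ U-cong (⊛-congˡ (F ^P k) (U-Fpow i i≤2)) ⟩
  U (F ^P k ⊛ G ^P i)        ≈⟨ U-cong (⊛-comm (F ^P k) (G ^P i)) ⟩
  U (G ^P i ⊛ F ^P k)        ≈⟨ U-Gpow⊛ i (F ^P k) ⟩
  F ^P i ⊛ U (F ^P k)        ∎

lemma2p8 : (i : ℕ) → i ≤ 2 → (k : ℕ) →
    (UI (UI ((F ^P i) ⊛ (G ^P k))) ≈ (F ^P i) ⊛ T (Fpow k))
    × (U (U ((F ^P i) ⊛ (G ^P k))) ⊕ (F ^P i) ⊛ (G ^P k) ≈ (F ^P i) ⊛ T (Fpow k))
lemma2p8 i i≤2 k = ≋⇒≈ (≋-trans (UI-square P) U²P+P) , ≋⇒≈ U²P+P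
  where
  P = F ^P i ⊛ G ^P k
  U²P+P : U (U P) ⊕ P ≋ F ^P i ⊛ T (Fpow k)
  U²P+P = begin
    U (U P) ⊕ P                            ≈⟨ ⊕-congʳ (U²-Fpow⊛Gpow i i≤2 k) ⟩
    F ^P i ⊛ U (F ^P k) ⊕ F ^P i ⊛ G ^P k  ≈⟨ ⊛-distribˡ-⊕ (F ^P i) (U (F ^P k)) (G ^P k) ⟨
    F ^P i ⊛ (U (F ^P k) ⊕ G ^P k)         ≈⟨ ⊛-congˡ (F ^P i) (T-Fpow k) ⟨
    F ^P i ⊛ T (Fpow k)                    ∎
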